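{- Let $w$ be a recurrent infinite word over $\Sigma=\{0,\dots,\sigma-1\}$ generated by a morphism $\phi$ with $\det A_\phi=\pm1$. Then $w$ satisfies the WELLDOC property if and only if the Parikh vectors of the returns to the first letter $w_0$ of $w$ generate $\mathbb{Z}^\sigma$ as an additive group.
   Context: A morphism $\phi:\Sigma^*\to\Sigma^*$ is nonerasing; $w$ is generated by $\phi$ if $\phi(a)=as$ for a letter $a$ and nonempty word $s$ and $w=\lim_n\phi^n(a)$. $A_\phi$ is the $\sigma\times\sigma$ matrix with entry $|\phi(i)|_j$ in row $j$, column $i$. The Parikh vector of a finite word $u$ is $V_u=(|u|_0,\dots,|u|_{\sigma-1})$. For a factor $u$ of $w$ occurring at positions $a_0<a_1<\dots$, $X_u=\{V_{w[0,a_i)}\}$ and $X_{u,m}$ is its reduction mod $m$; WELLDOC means $X_{u,m}=(\mathbb{Z}/m\mathbb{Z})^\sigma$ for all $m\ge1$ and all factors $u$. A return to $u$ is a factor $w[a_i,a_{i+1})$. Recurrent: every factor occurs infinitely often. -}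

module Defs where

open import Data.Nat using (ℕ; zero; suc; _+_; _≤_; _<_; NonZero)
open import Data.Nat.DivMod using (_%_)
open import Data.Integer as ℤ using (ℤ; +_; -_)
open import Data.Fin using (Fin; punchIn) renaming (zero to fzero; suc to fsuc)
open import Data.List using (List; []; _∷_; length; filter; concatMap)
open import Data.Product using (Σ; ∃; _×_; _,_)
open import Relation.Binary.PropositionalEquality using (_≡_; _≢_)
open import Data.Fin using (_≟_)

Word : ℕ → Set
Word σ = List (Fin σ)

InfWord : ℕ → Set
InfWord σ = ℕ → Fin σ

count : ∀ {σ} → Fin σ → Word σ → ℕ
count c u = length (filter (_≟ c) u)

parikh : ∀ {σ} → Word σ → Fin σ → ℤ
parikh u c = + count c u

slice : ∀ {σ} → InfWord σ → ℕ → ℕ → Word σ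
slice w i zero    = []
slice w i (suc n) = w i ∷ slice w (suc i) n

Morphism : ℕ → Set
Morphism σ = Fin σ → Word σ

Nonerasing : ∀ {σ} → Morphism σ → Set
Nonerasing φ = ∀ a → φ a ≢ []

ext : ∀ {σ} → Morphism σ → Word σ → Word σ
ext φ = concatMap φ

iter : ∀ {σ} → Morphism σ → ℕ → Word σ → Word σ
iter φ zero    u = u
iter φ (suc n) u = ext φ (iter φ n u)

-- w is generated by φ: φ(a) = a s with s nonempty and w = lim φⁿ(a),
-- i.e. every φⁿ(a) is a prefix of w (|φⁿ(a)| → ∞ as s ≠ []).
GeneratedBy : ∀ {σ} → Morphism σ → InfWord σ → Set
GeneratedBy {σ} φ w =
  Σ (Fin σ) λ a → Σ (Word σ) λ s →
    (φ a ≡ a ∷ s) × (s ≢ []) ×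
    (∀ n → slice w 0 (length (iter φ n (a ∷ []))) ≡ iter φ n (a ∷ []))

incMatrix : ∀ {σ} → Morphism σ → Fin σ → Fin σ → ℤ
incMatrix φ j i = + count j (φ i)

sumFin : ∀ n → (Fin n → ℤ) → ℤ
sumFin zero    f = + 0
sumFin (suc n) f = f fzero ℤ.+ sumFin n (λ k → f (fsuc k))

sign : ℕ → ℤ
sign zero = + 1
sign (suc n) = - sign n

det : ∀ n → (Fin n → Fin n → ℤ) → ℤ
det zero    M = + 1
det (suc n) M =
  sumFin (suc n) λ j →
    sign (Data.Fin.toℕ j) ℤ.* (M fzero j ℤ.* det n (λ r k → M (fsuc r) (punchIn j k)))

OccursAt : ∀ {σ} → InfWord σ → Word σ → ℕ → Set
OccursAt w u i = slice w i (length u) ≡ u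

IsFactor : ∀ {σ} → InfWord σ → Word σ → Set
IsFactor w u = ∃ λ i → OccursAt w u i

Recurrent : ∀ {σ} → InfWord σ → Set
Recurrent w = ∀ u → IsFactor w u → ∀ N → ∃ λ i → N ≤ i × OccursAt w u i

-- WELLDOC: for every m ≥ 1 and every factor u, X_{u,m} = (ℤ/mℤ)^σ, i.e.
-- every residue vector is attained by V_{w[0,a)} mod m for some occurrence a of u.
WELLDOC : ∀ {σ} → InfWord σ → Set
WELLDOC {σ} w =
  ∀ (m : ℕ) .{{_ : NonZero m}} (u : Word σ) → IsFactor w u →
    ∀ (v : Fin σ → ℕ) → ∃ λ a → OccursAt w u a ×
      (∀ c → count c (slice w 0 a) % m ≡ v c % m)

IsReturn : ∀ {σ} → InfWord σ → Fin σ → ℕ → ℕ → Set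
IsReturn w b i j = (i < j) × (w i ≡ b) × (w j ≡ b) ×
  (∀ k → i < k → k < j → w k ≢ b)

Return : ∀ {σ} → InfWord σ → Fin σ → Set
Return w b = Σ ℕ λ i → Σ ℕ λ j → IsReturn w b i j

returnParikh : ∀ {σ} {w : InfWord σ} {b} → Return w b → Fin σ → ℤ
returnParikh {w = w} (i , j , _) = parikh (slice w i (j Data.Nat.∸ i))

combo : ∀ {σ} {w : InfWord σ} {b} → List (ℤ × Return w b) → Fin σ → ℤ
combo []              c = + 0
combo {w = w} ((k , r) ∷ rs) c = k ℤ.* returnParikh {w = w} r c ℤ.+ combo {w = w} rs c

ReturnsGenerate : ∀ {σ} → InfWord σ → Set
ReturnsGenerate {σ} w =
  ∀ (v : Fin σ → ℤ) → ∃ λ (rs : List (ℤ × Return w (w 0))) →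
    ∀ c → combo {w = w} rs c ≡ v c

module Submission where

open import Defs
open import Data.Empty using (⊥-elim)
open import Data.Fin using (Fin; punchIn; punchOut; toℕ; fromℕ<; combine; _≟_) renaming (zero to fzero; suc to fsuc)
open import Data.Fin.Properties using (punchInᵢ≢i; punchIn-punchOut; toℕ-fromℕ<; combine-injective; pigeonhole)
open import Data.Integer using (ℤ; +_; -_; -[1+_]; _+_; _*_; _-_; ∣_∣)
open import Data.Integer.DivMod using (_%ℕ_; _/ℕ_; a≡a%ℕn+[a/ℕn]*n; n%ℕd<d)
open import Data.Integer.Divisibility.Signed using (_∣_; divides; module _∣_; ∣⇒∣ᵤ; ∣m∣n⇒∣m+n; ∣m⇒∣-m; ∣n⇒∣m*n)
open import Data.Integer.Properties as ℤ using ()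
open import Data.Integer.Tactic.RingSolver using (solve-∀)
open import Data.List using (List; []; _∷_; _++_; length; filter)
open import Data.List.Properties using (length-++; length-++-≤ʳ; filter-++; concatMap-++; ∷-injectiveˡ; ∷-injectiveʳ)
open import Data.Nat as ℕ using (ℕ; zero; suc; NonZero)
open import Data.Nat.DivMod using (%-remove-+ʳ; m<n⇒m%n≡m)
import Data.Nat.Divisibility as ℕ
open import Data.Nat.Induction using (<-rec)
import Data.Nat.Properties as ℕ
open import Data.Product using (Σ; ∃; ∃₂; _×_; _,_; proj₁; proj₂)
open import Data.Sum using (_⊎_; inj₁; inj₂)
open import Data.Vec.Functional using (Vector; removeAt) renaming (_∷_ to _∷ᵛ_)
open import Function using (_∘_)
open import Function.Bundles using (_⇔_; mk⇔)
open import Relation.Binary.PropositionalEquality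
open import Relation.Nullary using (Dec; yes; no)
open import Algebra.Properties.Semiring.Sum ℤ.+-*-semiring
  using (sum; sum-syntax; sum-cong-≗; sum-remove; ∑-distrib-+; ∑-comm; *-distribˡ-sum; sum-replicate-zero)

open ≡-Reasoning

-- If det A_φ = ±1, then A_φ is invertible over ℤ (its inverse is ±adj A_φ), so it has finite
-- order modulo every m: there is T ≥ 1 with A_φ^T ≡ I (mod m), and then φⁿ preserves Parikh
-- vectors mod m whenever T ∣ n.  Let a = w₀.  For an occurrence i of a, w[0,i) a is a prefix of
-- φⁱ(a), so φⁿ(w[0,i)) is followed in w by the prefix φⁿ(a) of w; for n large this copy of φⁿ(a)
-- contains a copy of any given occurrence of a factor u.  Hence the residues mod m of prefixes
-- V_{w[0,i)} with w_i = a form a subsemigroup, thus a subgroup, of (ℤ/mℤ)^σ which contains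
-- every return vector; if the returns generate ℤ^σ this subgroup is everything, and shifting an
-- occurrence of u along it gives WELLDOC.
-- Conversely V_{w[0,i)} is a sum of returns whenever w_i = w₀.  WELLDOC mod 2 yields σ such
-- prefixes whose Parikh vectors are the unit vectors mod 2; their determinant D is odd, so by
-- the adjugate identity D·ℤ^σ lies in the span of the returns, and WELLDOC mod |D| finishes.

sumFin≡sum : ∀ n (f : Fin n → ℤ) → sumFin n f ≡ sum f
sumFin≡sum zero    f = refl
sumFin≡sum (suc n) f = cong (_+_ (f fzero)) (sumFin≡sum n (f ∘ fsuc))

∑-neg : ∀ {n} (f : Fin n → ℤ) → ∑[ i < n ] (- f i) ≡ - sum f
∑-neg f = trans (sum-cong-≗ (neg≡-1* ∘ f)) (trans (sym (*-distribˡ-sum (- + 1) f)) (sym (neg≡-1* _)))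
  where
  neg≡-1* : ∀ x → - x ≡ - + 1 * x
  neg≡-1* = solve-∀

∑-zero : ∀ {n} (f : Fin n → ℤ) → (∀ i → f i ≡ + 0) → sum f ≡ + 0
∑-zero {n} f f≡0 = trans (sum-cong-≗ f≡0) (sum-replicate-zero n)

∑-pick : ∀ {n} (f : Fin n → ℤ) c → (∀ k → k ≢ c → f k ≡ + 0) → sum f ≡ f c
∑-pick {suc n} f c vanish = begin
  sum f                             ≡⟨ sum-remove {i = c} f ⟩
  f c + ∑[ k < n ] f (punchIn c k)  ≡⟨ cong (_+_ (f c)) (∑-zero _ (λ k → vanish (punchIn c k) (punchInᵢ≢i c k))) ⟩
  f c + + 0                         ≡⟨ ℤ.+-identityʳ (f c) ⟩
  f c                               ∎

+-cancelˡ-≡ : ∀ x {y z : ℤ} → x + y ≡ x + z → y ≡ z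
+-cancelˡ-≡ x {y} {z} x+y≡x+z = begin
  y               ≡⟨ cancel x y ⟩
  - x + (x + y)   ≡⟨ cong (_+_ (- x)) x+y≡x+z ⟩
  - x + (x + z)   ≡⟨ cancel x z ⟨
  z               ∎
  where
  cancel : ∀ x y → y ≡ - x + (x + y)
  cancel = solve-∀

∑-offDiagonal-comm : ∀ {n} (H : Fin (suc n) → Fin (suc n) → ℤ) →
  ∑[ j < suc n ] ∑[ k < n ] H j (punchIn j k) ≡ ∑[ j < suc n ] ∑[ k < n ] H (punchIn j k) j
∑-offDiagonal-comm {n} H = +-cancelˡ-≡ (∑[ j < suc n ] H j j) (begin
  ∑[ j < suc n ] H j j + ∑[ j < suc n ] ∑[ k < n ] H j (punchIn j k)
    ≡⟨ ∑-distrib-+ (λ j → H j j) (λ j → ∑[ k < n ] H j (punchIn j k)) ⟨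
  ∑[ j < suc n ] (H j j + ∑[ k < n ] H j (punchIn j k))
    ≡⟨ sum-cong-≗ (λ j → sum-remove {i = j} (H j)) ⟨
  ∑[ j < suc n ] ∑[ c < suc n ] H j c
    ≡⟨ ∑-comm H ⟩
  ∑[ c < suc n ] ∑[ j < suc n ] H j c
    ≡⟨ sum-cong-≗ (λ c → sum-remove {i = c} (λ j → H j c)) ⟩
  ∑[ c < suc n ] (H c c + ∑[ k < n ] H (punchIn c k) c)
    ≡⟨ ∑-distrib-+ (λ c → H c c) (λ c → ∑[ k < n ] H (punchIn c k) c) ⟩
  ∑[ c < suc n ] H c c + ∑[ c < suc n ] ∑[ k < n ] H (punchIn c k) c ∎)

infix 4 _≡_mod_ _≡ᵛ_mod_

record _≡_mod_ (x y : ℤ) (m : ℕ) : Set where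
  constructor congruent
  field divides-difference : + m ∣ x - y

_≡ᵛ_mod_ : ∀ {n} → Vector ℤ n → Vector ℤ n → ℕ → Set
_≡ᵛ_mod_ u v m = ∀ c → u c ≡ v c mod m

module _ {m : ℕ} where

  mod-reflexive : ∀ {x y} → x ≡ y → x ≡ y mod m
  mod-reflexive {x} refl = congruent (divides (+ 0) (trans (ℤ.+-inverseʳ x) (sym (ℤ.*-zeroˡ (+ m)))))

  mod-refl : ∀ {x} → x ≡ x mod m
  mod-refl = mod-reflexive refl

  mod-sym : ∀ {x y} → x ≡ y mod m → y ≡ x mod m
  mod-sym {x} {y} (congruent m∣x-y) = congruent (subst (+ m ∣_) (neg-sub x y) (∣m⇒∣-m m∣x-y))
    where
    neg-sub : ∀ x y → - (x - y) ≡ y - x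
    neg-sub = solve-∀

  mod-trans : ∀ {x y z} → x ≡ y mod m → y ≡ z mod m → x ≡ z mod m
  mod-trans {x} {y} {z} (congruent m∣x-y) (congruent m∣y-z) =
    congruent (subst (+ m ∣_) (telescope x y z) (∣m∣n⇒∣m+n m∣x-y m∣y-z))
    where
    telescope : ∀ x y z → (x - y) + (y - z) ≡ x - z
    telescope = solve-∀

  mod-+ : ∀ {x y x′ y′} → x ≡ y mod m → x′ ≡ y′ mod m → x + x′ ≡ y + y′ mod m
  mod-+ {x} {y} {x′} {y′} (congruent m∣x-y) (congruent m∣x′-y′) =
    congruent (subst (+ m ∣_) (regroup x y x′ y′) (∣m∣n⇒∣m+n m∣x-y m∣x′-y′))
    where
    regroup : ∀ x y x′ y′ → (x - y) + (x′ - y′) ≡ (x + x′) - (y + y′)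
    regroup = solve-∀

  mod-*ˡ : ∀ a {x y} → x ≡ y mod m → a * x ≡ a * y mod m
  mod-*ˡ a {x} {y} (congruent m∣x-y) = congruent (subst (+ m ∣_) (distrib a x y) (∣n⇒∣m*n a m∣x-y))
    where
    distrib : ∀ a x y → a * (x - y) ≡ a * x - a * y
    distrib = solve-∀

  mod-∑ : ∀ {n} {f g : Fin n → ℤ} → (∀ i → f i ≡ g i mod m) → sum f ≡ sum g mod m
  mod-∑ {zero}  f≡g = mod-refl
  mod-∑ {suc n} f≡g = mod-+ (f≡g fzero) (mod-∑ (f≡g ∘ fsuc))

  mod-* : ∀ {x y x′ y′} → x ≡ y mod m → x′ ≡ y′ mod m → x * x′ ≡ y * y′ mod m
  mod-* {x} {y} {x′} {y′} x≡y x′≡y′ =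
    mod-trans (mod-*ˡ x x′≡y′)
      (mod-trans (mod-reflexive (ℤ.*-comm x y′))
        (mod-trans (mod-*ˡ y′ x≡y) (mod-reflexive (ℤ.*-comm y′ y))))

module _ (m : ℕ) .{{_ : NonZero m}} where

  %ℕ-≡⇒mod : ∀ x y → x %ℕ m ≡ y %ℕ m → x ≡ y mod m
  %ℕ-≡⇒mod x y x%m≡y%m = congruent (divides (x /ℕ m - y /ℕ m) (begin
    x - y
      ≡⟨ cong₂ _-_ (a≡a%ℕn+[a/ℕn]*n x m) (a≡a%ℕn+[a/ℕn]*n y m) ⟩
    (+ (x %ℕ m) + x /ℕ m * + m) - (+ (y %ℕ m) + y /ℕ m * + m)
      ≡⟨ cong (λ r → (+ (x %ℕ m) + x /ℕ m * + m) - (+ r + y /ℕ m * + m)) x%m≡y%m ⟨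
    (+ (x %ℕ m) + x /ℕ m * + m) - (+ (x %ℕ m) + y /ℕ m * + m)
      ≡⟨ cancel (+ (x %ℕ m)) (x /ℕ m) (y /ℕ m) (+ m) ⟩
    (x /ℕ m - y /ℕ m) * + m ∎))
    where
    cancel : ∀ r a b m → (r + a * m) - (r + b * m) ≡ (a - b) * m
    cancel = solve-∀

  mod⇒%-≡ : ∀ x y → + x ≡ + y mod m → x ℕ.% m ≡ y ℕ.% m
  mod⇒%-≡ x y x≡y = by-cases (ℕ.≤-total y x)
    where
    ≤-case : ∀ {x y} → y ℕ.≤ x → + x ≡ + y mod m → y ℕ.% m ≡ x ℕ.% m
    ≤-case {x} {y} y≤x (congruent m∣x-y) =
      trans (sym (%-remove-+ʳ y m∣x∸y)) (cong (ℕ._% m) (ℕ.m+[n∸m]≡n y≤x))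
      where
      m∣x∸y : m ℕ.∣ x ℕ.∸ y
      m∣x∸y = ∣⇒∣ᵤ (subst (+ m ∣_) (trans (ℤ.m-n≡m⊖n x y) (ℤ.⊖-≥ y≤x)) m∣x-y)
    by-cases : y ℕ.≤ x ⊎ x ℕ.≤ y → x ℕ.% m ≡ y ℕ.% m
    by-cases (inj₁ y≤x) = sym (≤-case y≤x x≡y)
    by-cases (inj₂ x≤y) = ≤-case x≤y (mod-sym x≡y)

residue : ∀ m .{{_ : NonZero m}} → ℤ → Fin m
residue m x = fromℕ< (n%ℕd<d x m)

residue-injective : ∀ m .{{_ : NonZero m}} x y → residue m x ≡ residue m y → x ≡ y mod m
residue-injective m x y eq =
  %ℕ-≡⇒mod m x y (trans (sym (toℕ-fromℕ< (n%ℕd<d x m)))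
                        (trans (cong toℕ eq) (toℕ-fromℕ< (n%ℕd<d y m))))

odd⇒≢0 : ∀ {x} → x ≡ + 1 mod 2 → x ≢ + 0
odd⇒≢0 (congruent 2∣x-1) refl with ℕ.∣1⇒≡1 (∣⇒∣ᵤ 2∣x-1)
... | ()

-- Determinants

Matrix : ℕ → Set
Matrix n = Fin n → Fin n → ℤ

δ : ∀ {n} → Fin n → Fin n → ℤ
δ fzero    fzero    = + 1
δ fzero    (fsuc j) = + 0
δ (fsuc i) fzero    = + 0
δ (fsuc i) (fsuc j) = δ i j

δ-diag : ∀ {n} (i : Fin n) → δ i i ≡ + 1
δ-diag fzero    = refl
δ-diag (fsuc i) = δ-diag i

δ-≢ : ∀ {n} {i j : Fin n} → i ≢ j → δ i j ≡ + 0
δ-≢ {i = fzero}  {fzero}  i≢j = ⊥-elim (i≢j refl)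
δ-≢ {i = fzero}  {fsuc j} i≢j = refl
δ-≢ {i = fsuc i} {fzero}  i≢j = refl
δ-≢ {i = fsuc i} {fsuc j} i≢j = δ-≢ (i≢j ∘ cong fsuc)

δ-sym : ∀ {n} (i j : Fin n) → δ i j ≡ δ j i
δ-sym fzero    fzero    = refl
δ-sym fzero    (fsuc j) = refl
δ-sym (fsuc i) fzero    = refl
δ-sym (fsuc i) (fsuc j) = δ-sym i j

sgn : ∀ {n} → Fin n → ℤ
sgn j = sign (toℕ j)

sgn-involutive : ∀ {n} (j : Fin n) → sgn j * sgn j ≡ + 1
sgn-involutive j = go (toℕ j)
  where
  go : ∀ k → sign k * sign k ≡ + 1
  go zero    = refl
  go (suc k) = trans (neg*neg (sign k)) (go k)
    where
    neg*neg : ∀ x → - x * - x ≡ x * x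
    neg*neg = solve-∀

minor : ∀ {n} → Matrix (suc n) → Fin (suc n) → Fin (suc n) → Matrix n
minor M r c i k = M (punchIn r i) (punchIn c k)

det-expand : ∀ {n} (M : Matrix (suc n)) →
  det (suc n) M ≡ ∑[ j < suc n ] (sgn j * (M fzero j * det n (minor M fzero j)))
det-expand {n} M = sumFin≡sum (suc n) (λ j → sgn j * (M fzero j * det n (minor M fzero j)))

det-cong : ∀ n {M N : Matrix n} → (∀ r c → M r c ≡ N r c) → det n M ≡ det n N
det-cong zero    _   = refl
det-cong (suc n) {M} {N} M≡N = begin
  det (suc n) M                                                  ≡⟨ det-expand M ⟩
  ∑[ j < suc n ] (sgn j * (M fzero j * det n (minor M fzero j))) ≡⟨ sum-cong-≗ expansion-cong ⟩
  ∑[ j < suc n ] (sgn j * (N fzero j * det n (minor N fzero j))) ≡⟨ det-expand N ⟨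
  det (suc n) N                                                  ∎
  where
  expansion-cong : ∀ j → sgn j * (M fzero j * det n (minor M fzero j)) ≡
                         sgn j * (N fzero j * det n (minor N fzero j))
  expansion-cong j = cong₂ (λ x y → sgn j * (x * y)) (M≡N fzero j)
                           (det-cong n (λ r k → M≡N (fsuc r) (punchIn j k)))

det-cong-mod : ∀ {m} n {M N : Matrix n} → (∀ r c → M r c ≡ N r c mod m) → det n M ≡ det n N mod m
det-cong-mod zero    _ = mod-refl
det-cong-mod (suc n) {M} {N} M≡N =
  mod-trans (mod-reflexive (det-expand M))
    (mod-trans (mod-∑ (λ j → mod-*ˡ (sgn j) (mod-* (M≡N fzero j) (minor-cong j))))
               (mod-reflexive (sym (det-expand N))))
  where
  minor-cong : ∀ j → det n (minor M fzero j) ≡ det n (minor N fzero j) mod _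
  minor-cong j = det-cong-mod n (λ r k → M≡N (fsuc r) (punchIn j k))

det-δ : ∀ n → det n δ ≡ + 1
det-δ zero    = refl
det-δ (suc n) = begin
  det (suc n) δ                ≡⟨ det-expand {n} δ ⟩
  ∑[ j < suc n ] term j        ≡⟨ ∑-pick term fzero off-diagonal ⟩
  + 1 * (+ 1 * det n δ)        ≡⟨ cong (λ d → + 1 * (+ 1 * d)) (det-δ n) ⟩
  + 1                          ∎
  where
  term : Fin (suc n) → ℤ
  term j = sgn j * (δ fzero j * det n (minor δ fzero j))
  off-diagonal : ∀ j → j ≢ fzero → term j ≡ + 0
  off-diagonal j j≢0 = trans (cong (λ e → sgn j * (e * det n (minor δ fzero j))) (δ-≢ (j≢0 ∘ sym)))
                             (vanish (sgn j) (det n (minor δ fzero j)))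
    where
    vanish : ∀ s d → s * (+ 0 * d) ≡ + 0
    vanish = solve-∀

-- A total punchOut; the junk value punchOut′ j j is never used.
punchOut′ : ∀ {n} → Fin (suc (suc n)) → Fin (suc (suc n)) → Fin (suc n)
punchOut′ fzero    fzero    = fzero
punchOut′ fzero    (fsuc c) = c
punchOut′ (fsuc j) fzero    = fzero
punchOut′ {zero}  (fsuc j) (fsuc c) = fzero
punchOut′ {suc n} (fsuc j) (fsuc c) = fsuc (punchOut′ j c)

punchOut′-punchIn : ∀ {n} (j : Fin (suc (suc n))) k → punchOut′ j (punchIn j k) ≡ k
punchOut′-punchIn fzero k = refl
punchOut′-punchIn {zero}  (fsuc fzero) fzero    = refl
punchOut′-punchIn {suc n} (fsuc j)     fzero    = refl
punchOut′-punchIn {suc n} (fsuc j)     (fsuc k) = cong fsuc (punchOut′-punchIn j k)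

punchIn-punchOut′-comm : ∀ {n} (j c : Fin (suc (suc n))) → j ≢ c → ∀ k →
  punchIn j (punchIn (punchOut′ j c) k) ≡ punchIn c (punchIn (punchOut′ c j) k)
punchIn-punchOut′-comm fzero    fzero    j≢c k = ⊥-elim (j≢c refl)
punchIn-punchOut′-comm fzero    (fsuc c) j≢c k = refl
punchIn-punchOut′-comm (fsuc j) fzero    j≢c k = refl
punchIn-punchOut′-comm {zero}  (fsuc fzero) (fsuc fzero) j≢c k = ⊥-elim (j≢c refl)
punchIn-punchOut′-comm {suc n} (fsuc j) (fsuc c) j≢c fzero    = refl
punchIn-punchOut′-comm {suc n} (fsuc j) (fsuc c) j≢c (fsuc k) =
  cong fsuc (punchIn-punchOut′-comm j c (j≢c ∘ cong fsuc) k)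

sgn-punchOut′-anticomm : ∀ {n} (j c : Fin (suc (suc n))) → j ≢ c →
  sgn j * sgn (punchOut′ j c) ≡ - (sgn c * sgn (punchOut′ c j))
sgn-punchOut′-anticomm fzero    fzero    j≢c = ⊥-elim (j≢c refl)
sgn-punchOut′-anticomm fzero    (fsuc c) j≢c = flip (sgn c)
  where
  flip : ∀ x → + 1 * x ≡ - (- x * + 1)
  flip = solve-∀
sgn-punchOut′-anticomm (fsuc j) fzero    j≢c = flip (sgn j)
  where
  flip : ∀ x → - x * + 1 ≡ - (+ 1 * x)
  flip = solve-∀
sgn-punchOut′-anticomm {zero}  (fsuc fzero) (fsuc fzero) j≢c = ⊥-elim (j≢c refl)
sgn-punchOut′-anticomm {suc n} (fsuc j)     (fsuc c)     j≢c = begin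
  - sgn j * - sgn (punchOut′ j c)  ≡⟨ neg*neg (sgn j) _ ⟩
  sgn j * sgn (punchOut′ j c)      ≡⟨ sgn-punchOut′-anticomm j c (j≢c ∘ cong fsuc) ⟩
  - (sgn c * sgn (punchOut′ c j))  ≡⟨ cong -_ (neg*neg (sgn c) _) ⟨
  - (- sgn c * - sgn (punchOut′ c j)) ∎
  where
  neg*neg : ∀ x y → - x * - y ≡ x * y
  neg*neg = solve-∀

swap01 : ∀ {n} {A : Set} → Vector A (suc (suc n)) → Vector A (suc (suc n))
swap01 M = M (fsuc fzero) ∷ᵛ M fzero ∷ᵛ (M ∘ fsuc ∘ fsuc)

doubleExpansionTerm : ∀ {n} → Matrix (suc (suc n)) → Fin (suc (suc n)) → Fin (suc (suc n)) → ℤ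
doubleExpansionTerm {n} M j c =
  sgn j * sgn (punchOut′ j c) * M fzero j * M (fsuc fzero) c *
  det n (λ r k → M (fsuc (fsuc r)) (punchIn j (punchIn (punchOut′ j c) k)))

det-expand₂ : ∀ {n} (M : Matrix (suc (suc n))) →
  det (suc (suc n)) M ≡ ∑[ j < suc (suc n) ] ∑[ k < suc n ] doubleExpansionTerm M j (punchIn j k)
det-expand₂ {n} M = trans (det-expand M) (sum-cong-≗ expand-minor)
  where
  expand-minor : ∀ j → sgn j * (M fzero j * det (suc n) (minor M fzero j)) ≡
                       ∑[ k < suc n ] doubleExpansionTerm M j (punchIn j k)
  expand-minor j = begin
    sgn j * (M fzero j * det (suc n) M′)
      ≡⟨ cong (λ d → sgn j * (M fzero j * d)) (det-expand M′) ⟩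
    sgn j * (M fzero j * ∑[ k < suc n ] t k)
      ≡⟨ cong (sgn j *_) (*-distribˡ-sum (M fzero j) t) ⟩
    sgn j * ∑[ k < suc n ] (M fzero j * t k)
      ≡⟨ *-distribˡ-sum (sgn j) (λ k → M fzero j * t k) ⟩
    ∑[ k < suc n ] (sgn j * (M fzero j * t k))
      ≡⟨ sum-cong-≗ term-at ⟩
    ∑[ k < suc n ] doubleExpansionTerm M j (punchIn j k) ∎
    where
    M′ = minor M fzero j
    t : Fin (suc n) → ℤ
    t k = sgn k * (M′ fzero k * det n (minor M′ fzero k))
    reassoc : ∀ a b c d e → a * (b * (c * (d * e))) ≡ a * c * b * d * e
    reassoc = solve-∀
    term-at : ∀ k → sgn j * (M fzero j * t k) ≡ doubleExpansionTerm M j (punchIn j k)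
    term-at k rewrite punchOut′-punchIn j k =
      reassoc (sgn j) (M fzero j) (sgn k) (M′ fzero k) (det n (minor M′ fzero k))

doubleExpansionTerm-swap01 : ∀ {n} (M : Matrix (suc (suc n))) j c → j ≢ c →
  doubleExpansionTerm (swap01 M) j c ≡ - doubleExpansionTerm M c j
doubleExpansionTerm-swap01 {n} M j c j≢c =
  trans (cong₂ (λ ε d → ε * M (fsuc fzero) j * M fzero c * d)
               (sgn-punchOut′-anticomm j c j≢c)
               (det-cong n (λ r k → cong (M (fsuc (fsuc r))) (punchIn-punchOut′-comm j c j≢c k))))
        (reorder (sgn c * sgn (punchOut′ c j)) (M (fsuc fzero) j) (M fzero c)
                 (det n (λ r k → M (fsuc (fsuc r)) (punchIn c (punchIn (punchOut′ c j) k)))))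
  where
  reorder : ∀ ε x y d → - ε * x * y * d ≡ - (ε * y * x * d)
  reorder = solve-∀

det-swap01 : ∀ {n} (M : Matrix (suc (suc n))) → det (suc (suc n)) (swap01 M) ≡ - det (suc (suc n)) M
det-swap01 {n} M = begin
  det (suc (suc n)) (swap01 M)
    ≡⟨ det-expand₂ (swap01 M) ⟩
  ∑[ j < suc (suc n) ] ∑[ k < suc n ] doubleExpansionTerm (swap01 M) j (punchIn j k)
    ≡⟨ sum-cong-≗ (λ j → sum-cong-≗ (λ k →
         doubleExpansionTerm-swap01 M j (punchIn j k) (punchInᵢ≢i j k ∘ sym))) ⟩
  ∑[ j < suc (suc n) ] ∑[ k < suc n ] (- doubleExpansionTerm M (punchIn j k) j)
    ≡⟨ sum-cong-≗ (λ j → ∑-neg (λ k → doubleExpansionTerm M (punchIn j k) j)) ⟩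
  ∑[ j < suc (suc n) ] (- ∑[ k < suc n ] doubleExpansionTerm M (punchIn j k) j)
    ≡⟨ ∑-neg (λ j → ∑[ k < suc n ] doubleExpansionTerm M (punchIn j k) j) ⟩
  - (∑[ j < suc (suc n) ] ∑[ k < suc n ] doubleExpansionTerm M (punchIn j k) j)
    ≡⟨ cong -_ (∑-offDiagonal-comm (doubleExpansionTerm M)) ⟨
  - (∑[ j < suc (suc n) ] ∑[ k < suc n ] doubleExpansionTerm M j (punchIn j k))
    ≡⟨ cong -_ (det-expand₂ M) ⟨
  - det (suc (suc n)) M ∎

x≡-x⇒x≡0 : ∀ {x : ℤ} → x ≡ - x → x ≡ + 0
x≡-x⇒x≡0 {+ zero}   _  = refl
x≡-x⇒x≡0 {+ suc _}  ()
x≡-x⇒x≡0 { -[1+ _ ]} ()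

equal-rows01⇒det≡0 : ∀ {n} (M : Matrix (suc (suc n))) → (∀ c → M fzero c ≡ M (fsuc fzero) c) →
  det (suc (suc n)) M ≡ + 0
equal-rows01⇒det≡0 {n} M row0≡row1 =
  x≡-x⇒x≡0 (trans (sym (det-cong (suc (suc n)) swap01-M≡M)) (det-swap01 M))
  where
  swap01-M≡M : ∀ r c → swap01 M r c ≡ M r c
  swap01-M≡M fzero           c = sym (row0≡row1 c)
  swap01-M≡M (fsuc fzero)    c = row0≡row1 c
  swap01-M≡M (fsuc (fsuc r)) c = refl

det-moveToFront : ∀ {n} (M : Matrix (suc n)) r →
  det (suc n) (M r ∷ᵛ removeAt M r) ≡ sgn r * det (suc n) M
det-moveToFront {n} M fzero =
  trans (det-cong (suc n) {M fzero ∷ᵛ removeAt M fzero} {M} λ { fzero c → refl ; (fsuc i) c → refl })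
        (sym (ℤ.*-identityˡ (det (suc n) M)))
det-moveToFront {suc n} M (fsuc r) = begin
  det (suc (suc n)) N
    ≡⟨ ℤ.neg-involutive (det (suc (suc n)) N) ⟨
  - - det (suc (suc n)) N
    ≡⟨ cong -_ (det-swap01 N) ⟨
  - det (suc (suc n)) (swap01 N)
    ≡⟨ cong -_ (det-expand (swap01 N)) ⟩
  - ∑[ c < suc (suc n) ] (sgn c * (M fzero c * det (suc n) (minor (swap01 N) fzero c)))
    ≡⟨ cong -_ (sum-cong-≗ λ c → cong (λ d → sgn c * (M fzero c * d)) (minor-swap01 c)) ⟩
  - ∑[ c < suc (suc n) ] (sgn c * (M fzero c * (sgn r * det (suc n) (minor M fzero c))))
    ≡⟨ cong -_ (sum-cong-≗ λ c → pull-out (sgn c) (M fzero c) (sgn r) (det (suc n) (minor M fzero c))) ⟩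
  - ∑[ c < suc (suc n) ] (sgn r * (sgn c * (M fzero c * det (suc n) (minor M fzero c))))
    ≡⟨ cong -_ (*-distribˡ-sum (sgn r) (λ c → sgn c * (M fzero c * det (suc n) (minor M fzero c)))) ⟨
  - (sgn r * ∑[ c < suc (suc n) ] (sgn c * (M fzero c * det (suc n) (minor M fzero c))))
    ≡⟨ cong (λ d → - (sgn r * d)) (det-expand M) ⟨
  - (sgn r * det (suc (suc n)) M)
    ≡⟨ ℤ.neg-distribˡ-* (sgn r) (det (suc (suc n)) M) ⟩
  sgn (fsuc r) * det (suc (suc n)) M ∎
  where
  N = M (fsuc r) ∷ᵛ removeAt M (fsuc r)
  minor-swap01 : ∀ c → det (suc n) (minor (swap01 N) fzero c) ≡ sgn r * det (suc n) (minor M fzero c)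
  minor-swap01 c =
    trans (det-cong (suc n) {minor (swap01 N) fzero c} {minor M fzero c r ∷ᵛ removeAt (minor M fzero c) r}
                    λ { fzero k → refl ; (fsuc i) k → refl })
          (det-moveToFront (minor M fzero c) r)
  pull-out : ∀ a b c d → a * (b * (c * d)) ≡ c * (a * (b * d))
  pull-out = solve-∀

equal-rows0-suc⇒det≡0 : ∀ {n} (M : Matrix (suc n)) j → (∀ c → M fzero c ≡ M (fsuc j) c) →
  det (suc n) M ≡ + 0
equal-rows0-suc⇒det≡0 {suc n} M j row0≡row-j = begin
  det (suc (suc n)) M            ≡⟨ sgn²-cancel (det (suc (suc n)) M) ⟩
  s * (s * det (suc (suc n)) M)  ≡⟨ cong (s *_) (det-moveToFront M (fsuc j)) ⟨
  s * det (suc (suc n)) N        ≡⟨ cong (s *_) (equal-rows01⇒det≡0 N (sym ∘ row0≡row-j)) ⟩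
  s * + 0                        ≡⟨ ℤ.*-zeroʳ s ⟩
  + 0                            ∎
  where
  s = sgn (fsuc j)
  N = M (fsuc j) ∷ᵛ removeAt M (fsuc j)
  sgn²-cancel : ∀ x → x ≡ s * (s * x)
  sgn²-cancel x =
    sym (trans (sym (ℤ.*-assoc s s x)) (trans (cong (_* x) (sgn-involutive (fsuc j))) (ℤ.*-identityˡ x)))

cofactor : ∀ {n} → Matrix (suc n) → Fin (suc n) → Fin (suc n) → ℤ
cofactor {n} M r c = sgn r * (sgn c * det n (minor M r c))

cofactor-expansion : ∀ {n} (M : Matrix (suc n)) k r →
  ∑[ c < suc n ] (M k c * cofactor M r c) ≡ δ k r * det (suc n) M
cofactor-expansion {n} M k r = trans expand-along-r (row-k-at-r (k ≟ r))
  where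
  N = M k ∷ᵛ removeAt M r
  expand-along-r : ∑[ c < suc n ] (M k c * cofactor M r c) ≡ sgn r * det (suc n) N
  expand-along-r = begin
    ∑[ c < suc n ] (M k c * cofactor M r c)
      ≡⟨ sum-cong-≗ (λ c → reorder (M k c) (sgn r) (sgn c) (det n (minor M r c))) ⟩
    ∑[ c < suc n ] (sgn r * (sgn c * (M k c * det n (minor M r c))))
      ≡⟨ *-distribˡ-sum (sgn r) (λ c → sgn c * (M k c * det n (minor M r c))) ⟨
    sgn r * ∑[ c < suc n ] (sgn c * (M k c * det n (minor M r c)))
      ≡⟨ cong (sgn r *_) (det-expand N) ⟨
    sgn r * det (suc n) N ∎
    where
    reorder : ∀ x a b d → x * (a * (b * d)) ≡ a * (b * (x * d))
    reorder = solve-∀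
  row-k-at-r : Dec (k ≡ r) → sgn r * det (suc n) N ≡ δ k r * det (suc n) M
  row-k-at-r (yes refl) = begin
    sgn k * det (suc n) N            ≡⟨ cong (sgn k *_) (det-moveToFront M k) ⟩
    sgn k * (sgn k * det (suc n) M)  ≡⟨ ℤ.*-assoc (sgn k) (sgn k) _ ⟨
    sgn k * sgn k * det (suc n) M    ≡⟨ cong (_* det (suc n) M) (trans (sgn-involutive k) (sym (δ-diag k))) ⟩
    δ k k * det (suc n) M            ∎
  row-k-at-r (no k≢r) = begin
    sgn r * det (suc n) N            ≡⟨ cong (sgn r *_) (equal-rows0-suc⇒det≡0 N _ row-k-twice) ⟩
    sgn r * + 0                      ≡⟨ ℤ.*-zeroʳ (sgn r) ⟩
    + 0                              ≡⟨ ℤ.*-zeroˡ (det (suc n) M) ⟨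
    + 0 * det (suc n) M              ≡⟨ cong (_* det (suc n) M) (δ-≢ k≢r) ⟨
    δ k r * det (suc n) M            ∎
    where
    r≢k = k≢r ∘ sym
    row-k-twice : ∀ c → N fzero c ≡ N (fsuc (punchOut r≢k)) c
    row-k-twice c = cong (λ i → M i c) (sym (punchIn-punchOut r≢k))

-- Powers of a unimodular matrix modulo m

infixr 8 _·_

_·_ : ∀ {n} → Matrix n → Vector ℤ n → Vector ℤ n
(M · v) k = ∑[ c < _ ] (M k c * v c)

_^_·_ : ∀ {n} → Matrix n → ℕ → Vector ℤ n → Vector ℤ n
M ^ zero  · v = v
M ^ suc t · v = M · (M ^ t · v)

·-cong : ∀ {n} (M : Matrix n) {u v : Vector ℤ n} → u ≗ v → M · u ≗ M · v
·-cong M u≗v k = sum-cong-≗ (λ c → cong (M k c *_) (u≗v c))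

·-cong-mod : ∀ {n m} (M : Matrix n) {u v : Vector ℤ n} → u ≡ᵛ v mod m → M · u ≡ᵛ M · v mod m
·-cong-mod M u≡v k = mod-∑ (λ c → mod-*ˡ (M k c) (u≡v c))

^·-cong : ∀ {n} (M : Matrix n) t {u v : Vector ℤ n} → u ≗ v → M ^ t · u ≗ M ^ t · v
^·-cong M zero    u≗v = u≗v
^·-cong M (suc t) u≗v = ·-cong M (^·-cong M t u≗v)

^·-cong-mod : ∀ {n m} (M : Matrix n) t {u v : Vector ℤ n} →
  u ≡ᵛ v mod m → M ^ t · u ≡ᵛ M ^ t · v mod m
^·-cong-mod M zero    u≡v = u≡v
^·-cong-mod M (suc t) u≡v = ·-cong-mod M (^·-cong-mod M t u≡v)

^·-+ : ∀ {n} (M : Matrix n) s t v → M ^ (s ℕ.+ t) · v ≗ M ^ s · (M ^ t · v)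
^·-+ M zero    t v = λ _ → refl
^·-+ M (suc s) t v = ·-cong M (^·-+ M s t v)

^·-suc : ∀ {n} (M : Matrix n) t v → M ^ suc t · v ≗ M ^ t · (M · v)
^·-suc M t v k = trans (cong (λ s → (M ^ s · v) k) (ℕ.+-comm 1 t)) (^·-+ M t 1 v k)

∑-δ : ∀ {n} (v : Vector ℤ n) c → ∑[ k < n ] (v k * δ k c) ≡ v c
∑-δ v c = trans (∑-pick _ c (λ k k≢c → trans (cong (v k *_) (δ-≢ k≢c)) (ℤ.*-zeroʳ (v k))))
                    (trans (cong (v c *_) (δ-diag c)) (ℤ.*-identityʳ (v c)))

^·-linear : ∀ {n} (M : Matrix n) t v c → (M ^ t · v) c ≡ ∑[ k < n ] (v k * (M ^ t · δ k) c)
^·-linear M zero    v c = sym (∑-δ v c)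
^·-linear {n} M (suc t) v c = begin
  ∑[ i < n ] (M c i * (M ^ t · v) i)
    ≡⟨ sum-cong-≗ (λ i → cong (M c i *_) (^·-linear M t v i)) ⟩
  ∑[ i < n ] (M c i * ∑[ k < n ] (v k * (M ^ t · δ k) i))
    ≡⟨ sum-cong-≗ (λ i → *-distribˡ-sum (M c i) (λ k → v k * (M ^ t · δ k) i)) ⟩
  ∑[ i < n ] ∑[ k < n ] (M c i * (v k * (M ^ t · δ k) i))
    ≡⟨ ∑-comm (λ i k → M c i * (v k * (M ^ t · δ k) i)) ⟩
  ∑[ k < n ] ∑[ i < n ] (M c i * (v k * (M ^ t · δ k) i))
    ≡⟨ sum-cong-≗ (λ k → trans (sum-cong-≗ (λ i → swap (M c i) (v k) ((M ^ t · δ k) i)))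
                                (sym (*-distribˡ-sum (v k) (λ i → M c i * (M ^ t · δ k) i)))) ⟩
  ∑[ k < n ] (v k * (M ^ suc t · δ k) c) ∎
  where
  swap : ∀ a b d → a * (b * d) ≡ b * (a * d)
  swap = solve-∀

encode : ∀ {k} n → (Fin n → Fin k) → Fin (k ℕ.^ n)
encode zero    f = fzero
encode (suc n) f = combine (f fzero) (encode n (f ∘ fsuc))

encode-injective : ∀ {k} n (f g : Fin n → Fin k) → encode n f ≡ encode n g → f ≗ g
encode-injective (suc n) f g eq fzero    = proj₁ (combine-injective (f fzero) _ (g fzero) _ eq)
encode-injective (suc n) f g eq (fsuc i) =
  encode-injective n (f ∘ fsuc) (g ∘ fsuc) (proj₂ (combine-injective (f fzero) _ (g fzero) _ eq)) i

eventually-periodic-mod : ∀ {n} (G : Matrix n) m .{{_ : NonZero m}} →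
  ∃₂ λ s t → s ℕ.< t × ∀ k → G ^ s · δ k ≡ᵛ G ^ t · δ k mod m
eventually-periodic-mod {n} G m with pigeonhole (ℕ.n<1+n ((m ℕ.^ n) ℕ.^ n)) (state ∘ toℕ)
  where
  state : ℕ → Fin ((m ℕ.^ n) ℕ.^ n)
  state t = encode n (λ k → encode n (λ c → residue m ((G ^ t · δ k) c)))
... | s , t , s<t , same-state = toℕ s , toℕ t , s<t , λ k c →
  residue-injective m _ _ (encode-injective n _ _ (encode-injective n _ _ same-state k) c)

module Unimodular {n} (A : Matrix (suc n)) (det²≡1 : det (suc n) A * det (suc n) A ≡ + 1) where

  inverse : Matrix (suc n)
  inverse c r = det (suc n) A * cofactor A r c

  ·-inverse : ∀ v → A · (inverse · v) ≗ v
  ·-inverse v k = begin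
    ∑[ c < suc n ] (A k c * ∑[ r < suc n ] (D * cofactor A r c * v r))
      ≡⟨ sum-cong-≗ (λ c → *-distribˡ-sum (A k c) (λ r → D * cofactor A r c * v r)) ⟩
    ∑[ c < suc n ] ∑[ r < suc n ] (A k c * (D * cofactor A r c * v r))
      ≡⟨ ∑-comm (λ c r → A k c * (D * cofactor A r c * v r)) ⟩
    ∑[ r < suc n ] ∑[ c < suc n ] (A k c * (D * cofactor A r c * v r))
      ≡⟨ sum-cong-≗ (λ r → trans (sum-cong-≗ (λ c → reorder (A k c) D (cofactor A r c) (v r)))
                                 (sym (*-distribˡ-sum (D * v r) (λ c → A k c * cofactor A r c)))) ⟩
    ∑[ r < suc n ] (D * v r * ∑[ c < suc n ] (A k c * cofactor A r c))
      ≡⟨ sum-cong-≗ (λ r → cong (D * v r *_) (cofactor-expansion A k r)) ⟩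
    ∑[ r < suc n ] (D * v r * (δ k r * D))
      ≡⟨ ∑-pick _ k (λ r r≢k → off-diagonal r (δ-≢ (r≢k ∘ sym))) ⟩
    D * v k * (δ k k * D)
      ≡⟨ cong (λ e → D * v k * (e * D)) (δ-diag k) ⟩
    D * v k * (+ 1 * D)
      ≡⟨ trans (square D (v k)) (trans (cong (_* v k) det²≡1) (ℤ.*-identityˡ (v k))) ⟩
    v k ∎
    where
    D = det (suc n) A
    reorder : ∀ a d c x → a * (d * c * x) ≡ d * x * (a * c)
    reorder = solve-∀
    off-diagonal : ∀ r → δ k r ≡ + 0 → D * v r * (δ k r * D) ≡ + 0
    off-diagonal r δ≡0 = trans (cong (λ e → D * v r * (e * D)) δ≡0) (annihilate D (v r))
      where
      annihilate : ∀ d x → d * x * (+ 0 * d) ≡ + 0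
      annihilate = solve-∀
    square : ∀ d x → d * x * (+ 1 * d) ≡ d * d * x
    square = solve-∀

  ^·-inverse : ∀ t v → A ^ t · (inverse ^ t · v) ≗ v
  ^·-inverse zero    v = λ _ → refl
  ^·-inverse (suc t) v k = begin
    (A ^ suc t · (inverse · (inverse ^ t · v))) k  ≡⟨ ^·-suc A t _ k ⟩
    (A ^ t · (A · (inverse · (inverse ^ t · v)))) k ≡⟨ ^·-cong A t (·-inverse (inverse ^ t · v)) k ⟩
    (A ^ t · (inverse ^ t · v)) k                  ≡⟨ ^·-inverse t v k ⟩
    v k                                            ∎

  inverse-cancel-mod : ∀ {m} t {u v} → inverse ^ t · u ≡ᵛ inverse ^ t · v mod m → u ≡ᵛ v mod m
  inverse-cancel-mod zero    u≡v = u≡v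
  inverse-cancel-mod (suc t) {u} {v} Gu≡Gv = inverse-cancel-mod t λ k →
    mod-trans (mod-reflexive (sym (·-inverse (inverse ^ t · u) k)))
              (mod-trans (·-cong-mod A Gu≡Gv k) (mod-reflexive (·-inverse (inverse ^ t · v) k)))

  periodic-of-collision : ∀ {m} s t → s ℕ.< t → (∀ k → inverse ^ s · δ k ≡ᵛ inverse ^ t · δ k mod m) →
    ∀ v → A ^ (t ℕ.∸ s) · v ≡ᵛ v mod m
  periodic-of-collision {m} s t s<t Gˢ≡Gᵗ v c =
    mod-trans (mod-reflexive (^·-linear A d v c))
              (mod-trans (mod-∑ (λ k → mod-*ˡ (v k) (A-fixes-basis k c))) (mod-reflexive (∑-δ v c)))
    where
    d = t ℕ.∸ s
    fixes-basis : ∀ k → δ k ≡ᵛ inverse ^ d · δ k mod m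
    fixes-basis k = inverse-cancel-mod s λ c →
      mod-trans (Gˢ≡Gᵗ k c)
        (mod-reflexive (trans (cong (λ e → (inverse ^ e · δ k) c) (sym (ℕ.m+[n∸m]≡n (ℕ.<⇒≤ s<t))))
                              (^·-+ inverse s d (δ k) c)))
    A-fixes-basis : ∀ k → A ^ d · δ k ≡ᵛ δ k mod m
    A-fixes-basis k c = mod-trans (^·-cong-mod A d (fixes-basis k) c) (mod-reflexive (^·-inverse d (δ k) c))

unimodular-periodic-mod : ∀ {n} (A : Matrix n) → det n A * det n A ≡ + 1 → ∀ m .{{_ : NonZero m}} →
  ∃ λ T → 0 ℕ.< T × ∀ v → A ^ T · v ≡ᵛ v mod m
unimodular-periodic-mod {zero}  A _ m = 1 , ℕ.z<s , λ v ()
unimodular-periodic-mod {suc n} A det²≡1 m =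
  let s , t , s<t , Gˢ≡Gᵗ = eventually-periodic-mod inverse m
  in t ℕ.∸ s , ℕ.m<n⇒0<n∸m s<t , periodic-of-collision s t s<t Gˢ≡Gᵗ
  where open Unimodular A det²≡1

^·-periodic-multiple : ∀ {n m} (A : Matrix n) T → (∀ v → A ^ T · v ≡ᵛ v mod m) →
  ∀ k v → A ^ (k ℕ.* T) · v ≡ᵛ v mod m
^·-periodic-multiple A T periodic zero    v c = mod-refl
^·-periodic-multiple A T periodic (suc k) v c =
  mod-trans (mod-reflexive (^·-+ A T (k ℕ.* T) v c))
            (mod-trans (periodic (A ^ (k ℕ.* T) · v) c) (^·-periodic-multiple A T periodic k v c))

count-++ : ∀ {σ} (c : Fin σ) (xs ys : Word σ) → count c (xs ++ ys) ≡ count c xs ℕ.+ count c ys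
count-++ c xs ys = trans (cong length (filter-++ (_≟ c) xs ys)) (length-++ (filter (_≟ c) xs))

parikh-++ : ∀ {σ} (xs ys : Word σ) c → parikh (xs ++ ys) c ≡ parikh xs c + parikh ys c
parikh-++ xs ys c = trans (cong +_ (count-++ c xs ys)) (ℤ.pos-+ (count c xs) (count c ys))

parikh-[_] : ∀ {σ} (y : Fin σ) → parikh (y ∷ []) ≗ δ y
parikh-[ y ] c with y ≟ c
... | yes refl = sym (δ-diag y)
... | no y≢c   = sym (δ-≢ y≢c)

parikh-ext : ∀ {σ} (φ : Morphism σ) xs → parikh (ext φ xs) ≗ incMatrix φ · parikh xs
parikh-ext {σ} φ [] c = sym (∑-zero _ (λ i → ℤ.*-zeroʳ (incMatrix φ c i)))
parikh-ext {σ} φ (y ∷ xs) c = begin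
  parikh (φ y ++ ext φ xs) c
    ≡⟨ parikh-++ (φ y) (ext φ xs) c ⟩
  incMatrix φ c y + parikh (ext φ xs) c
    ≡⟨ cong (_+_ (incMatrix φ c y)) (parikh-ext φ xs c) ⟩
  incMatrix φ c y + (incMatrix φ · parikh xs) c
    ≡⟨ cong (_+ (incMatrix φ · parikh xs) c) column-y ⟨
  ∑[ i < σ ] (incMatrix φ c i * δ y i) + ∑[ i < σ ] (incMatrix φ c i * parikh xs i)
    ≡⟨ ∑-distrib-+ (λ i → incMatrix φ c i * δ y i) (λ i → incMatrix φ c i * parikh xs i) ⟨
  ∑[ i < σ ] (incMatrix φ c i * δ y i + incMatrix φ c i * parikh xs i)
    ≡⟨ sum-cong-≗ (λ i → trans (sym (ℤ.*-distribˡ-+ (incMatrix φ c i) (δ y i) (parikh xs i)))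
                                (cong (incMatrix φ c i *_) (sym (cons i)))) ⟩
  (incMatrix φ · parikh (y ∷ xs)) c ∎
  where
  column-y : ∑[ i < σ ] (incMatrix φ c i * δ y i) ≡ incMatrix φ c y
  column-y = trans (sum-cong-≗ (λ i → cong (incMatrix φ c i *_) (δ-sym y i))) (∑-δ (incMatrix φ c) y)
  cons : ∀ i → parikh (y ∷ xs) i ≡ δ y i + parikh xs i
  cons i = trans (parikh-++ (y ∷ []) xs i) (cong (_+ parikh xs i) (parikh-[ y ] i))

parikh-iter : ∀ {σ} (φ : Morphism σ) t xs → parikh (iter φ t xs) ≗ incMatrix φ ^ t · parikh xs
parikh-iter φ zero    xs = λ _ → refl
parikh-iter φ (suc t) xs c = trans (parikh-ext φ (iter φ t xs) c) (·-cong (incMatrix φ) (parikh-iter φ t xs) c)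

iter-++ : ∀ {σ} (φ : Morphism σ) t xs ys → iter φ t (xs ++ ys) ≡ iter φ t xs ++ iter φ t ys
iter-++ φ zero    xs ys = refl
iter-++ φ (suc t) xs ys = trans (cong (ext φ) (iter-++ φ t xs ys)) (concatMap-++ φ (iter φ t xs) (iter φ t ys))

iter-+ : ∀ {σ} (φ : Morphism σ) s t xs → iter φ (s ℕ.+ t) xs ≡ iter φ s (iter φ t xs)
iter-+ φ zero    t xs = refl
iter-+ φ (suc s) t xs = cong (ext φ) (iter-+ φ s t xs)

length-ext : ∀ {σ} {φ : Morphism σ} → Nonerasing φ → ∀ xs → length xs ℕ.≤ length (ext φ xs)
length-ext nonerasing [] = ℕ.z≤n
length-ext {φ = φ} nonerasing (y ∷ xs) with φ y in φy≡
... | []     = ⊥-elim (nonerasing y φy≡)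
... | _ ∷ zs = ℕ.s≤s (ℕ.≤-trans (length-ext nonerasing xs) (length-++-≤ʳ (ext φ xs) {zs}))

module _ {σ} (w : InfWord σ) where

  prefixParikh : ℕ → Vector ℤ σ
  prefixParikh i = parikh (slice w 0 i)

  slice-++ : ∀ k i j → slice w k (i ℕ.+ j) ≡ slice w k i ++ slice w (k ℕ.+ i) j
  slice-++ k zero    j = cong (λ k′ → slice w k′ j) (sym (ℕ.+-identityʳ k))
  slice-++ k (suc i) j =
    cong (w k ∷_) (trans (slice-++ (suc k) i j) (cong (λ k′ → slice w (suc k) i ++ slice w k′ j) (sym (ℕ.+-suc k i))))

  prefixParikh-+ : ∀ i j → prefixParikh (i ℕ.+ j) ≗ λ c → prefixParikh i c + parikh (slice w i j) c
  prefixParikh-+ i j c = trans (cong (λ u → parikh u c) (slice-++ 0 i j)) (parikh-++ (slice w 0 i) (slice w i j) c)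

  occursAt-++⁻ : ∀ xs {ys} i → OccursAt w (xs ++ ys) i → OccursAt w xs i × OccursAt w ys (i ℕ.+ length xs)
  occursAt-++⁻ []       {ys} i occ = refl , subst (OccursAt w ys) (sym (ℕ.+-identityʳ i)) occ
  occursAt-++⁻ (x ∷ xs) {ys} i occ with occursAt-++⁻ xs (suc i) (∷-injectiveʳ occ)
  ... | xs-occ , ys-occ =
    cong₂ _∷_ (∷-injectiveˡ occ) xs-occ , subst (OccursAt w ys) (sym (ℕ.+-suc i (length xs))) ys-occ

  slice-prefix : ∀ {k k′ L} l → slice w k L ≡ slice w k′ L → l ℕ.≤ L → slice w k l ≡ slice w k′ l
  slice-prefix zero    eq _ = refl
  slice-prefix {L = suc L} (suc l) eq (ℕ.s≤s l≤L) =
    cong₂ _∷_ (∷-injectiveˡ eq) (slice-prefix l (∷-injectiveʳ eq) l≤L)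

  slice-shift : ∀ {k k′ L} j l → slice w k L ≡ slice w k′ L → j ℕ.+ l ℕ.≤ L →
    slice w (k ℕ.+ j) l ≡ slice w (k′ ℕ.+ j) l
  slice-shift {k} {k′} zero l eq l≤L rewrite ℕ.+-identityʳ k | ℕ.+-identityʳ k′ = slice-prefix l eq l≤L
  slice-shift {k} {k′} {suc L} (suc j) l eq (ℕ.s≤s j+l≤L) rewrite ℕ.+-suc k j | ℕ.+-suc k′ j =
    slice-shift {suc k} {suc k′} j l (∷-injectiveʳ eq) j+l≤L

-- Returns generate ℤ^σ ⇒ WELLDOC

module Generated {σ} (φ : Morphism σ) (w : InfWord σ) (nonerasing : Nonerasing φ)
                 (a : Fin σ) (s : Word σ) (φa≡as : φ a ≡ a ∷ s) (s≢[] : s ≢ [])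
                 (prefix : ∀ n → OccursAt w (iter φ n (a ∷ [])) 0) where

  φ^_[a] : ℕ → Word σ
  φ^ n [a] = iter φ n (a ∷ [])

  φ^[a]-head : ∀ n → ∃ λ r → φ^ n [a] ≡ a ∷ r
  φ^[a]-head zero    = [] , refl
  φ^[a]-head (suc n) with φ^[a]-head n
  ... | r , eq = s ++ ext φ r , trans (cong (ext φ) eq) (cong (_++ ext φ r) φa≡as)

  length-φ^[a] : ∀ n → n ℕ.< length (φ^ n [a])
  length-φ^[a] zero    = ℕ.z<s
  length-φ^[a] (suc n) with φ^[a]-head n | length-φ^[a] n
  ... | r , eq | n<|φⁿa| rewrite eq | φa≡as | length-++ s {ext φ r} =
    ℕ.s≤s (ℕ.≤-trans n<|φⁿa| (ℕ.+-mono-≤ (nonempty s s≢[]) (length-ext nonerasing r)))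
    where
    nonempty : ∀ (u : Word σ) → u ≢ [] → 1 ℕ.≤ length u
    nonempty []      u≢[] = ⊥-elim (u≢[] refl)
    nonempty (_ ∷ _) _    = ℕ.s≤s ℕ.z≤n

  imageOfPrefix : ℕ → ℕ → Word σ
  imageOfPrefix n i = iter φ n (slice w 0 i)

  imageOfPrefix-followed-by-φ^[a] : ∀ {i} → w i ≡ a → ∀ n →
    OccursAt w (imageOfPrefix n i) 0 × OccursAt w (φ^ n [a]) (length (imageOfPrefix n i))
  imageOfPrefix-followed-by-φ^[a] {i} wi≡a n =
    proj₁ image-occurs , proj₁ (occursAt-++⁻ w (φ^ n [a]) {iter φ n Y} (length X) (proj₂ image-occurs))
    where
    X = imageOfPrefix n i
    e = length (φ^ i [a]) ℕ.∸ suc i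
    Y = slice w (suc i) e
    length-split : length (φ^ i [a]) ≡ i ℕ.+ suc e
    length-split = trans (sym (ℕ.m+[n∸m]≡n (length-φ^[a] i))) (sym (ℕ.+-suc i e))
    φ^[a]-split : φ^ i [a] ≡ slice w 0 i ++ a ∷ Y
    φ^[a]-split = begin
      φ^ i [a]                             ≡⟨ prefix i ⟨
      slice w 0 (length (φ^ i [a]))        ≡⟨ cong (slice w 0) length-split ⟩
      slice w 0 (i ℕ.+ suc e)              ≡⟨ slice-++ w 0 i (suc e) ⟩
      slice w 0 i ++ w i ∷ Y               ≡⟨ cong (λ x → slice w 0 i ++ x ∷ Y) wi≡a ⟩
      slice w 0 i ++ a ∷ Y                 ∎
    φ^[a]-image : φ^ (n ℕ.+ i) [a] ≡ X ++ φ^ n [a] ++ iter φ n Y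
    φ^[a]-image = begin
      φ^ (n ℕ.+ i) [a]                   ≡⟨ iter-+ φ n i (a ∷ []) ⟩
      iter φ n (φ^ i [a])                ≡⟨ cong (iter φ n) φ^[a]-split ⟩
      iter φ n (slice w 0 i ++ a ∷ Y)    ≡⟨ iter-++ φ n (slice w 0 i) (a ∷ Y) ⟩
      X ++ iter φ n ((a ∷ []) ++ Y)      ≡⟨ cong (X ++_) (iter-++ φ n (a ∷ []) Y) ⟩
      X ++ φ^ n [a] ++ iter φ n Y        ∎
    image-occurs : OccursAt w X 0 × OccursAt w (φ^ n [a] ++ iter φ n Y) (length X)
    image-occurs = occursAt-++⁻ w X 0 (subst (λ u → OccursAt w u 0) φ^[a]-image (prefix (n ℕ.+ i)))

  module _ (det²≡1 : det σ (incMatrix φ) * det σ (incMatrix φ) ≡ + 1) (m : ℕ) .{{_ : NonZero m}} where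

    parikh-period : ∀ N → ∃ λ n → N ℕ.≤ n × ∀ xs → parikh (iter φ n xs) ≡ᵛ parikh xs mod m
    parikh-period N =
      let T , 0<T , periodic = unimodular-periodic-mod (incMatrix φ) det²≡1 m
      in N ℕ.* T , ℕ.m≤m*n N T {{ℕ.>-nonZero 0<T}} , λ xs c →
           mod-trans (mod-reflexive (parikh-iter φ (N ℕ.* T) xs c))
                     (^·-periodic-multiple (incMatrix φ) T periodic N (parikh xs) c)

    occurrence-translate : ∀ {i} → w i ≡ a → ∀ u {j} → OccursAt w u j →
      ∃ λ k → OccursAt w u k × prefixParikh w k ≡ᵛ (λ c → prefixParikh w i c + prefixParikh w j c) mod m
    occurrence-translate {i} wi≡a u {j} u-at-j with parikh-period (j ℕ.+ length u)
    ... | n , j+|u|≤n , period = length X ℕ.+ j , u-at-k , parikh-at-k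
      where
      X = imageOfPrefix n i
      L = length (φ^ n [a])
      j+|u|≤L : j ℕ.+ length u ℕ.≤ L
      j+|u|≤L = ℕ.≤-trans j+|u|≤n (ℕ.<⇒≤ (length-φ^[a] n))
      φ^[a]-twice : slice w (length X) L ≡ slice w 0 L
      φ^[a]-twice = trans (proj₂ (imageOfPrefix-followed-by-φ^[a] wi≡a n)) (sym (prefix n))
      u-at-k : OccursAt w u (length X ℕ.+ j)
      u-at-k = trans (slice-shift w j (length u) φ^[a]-twice j+|u|≤L) u-at-j
      parikh-at-k : prefixParikh w (length X ℕ.+ j) ≡ᵛ (λ c → prefixParikh w i c + prefixParikh w j c) mod m
      parikh-at-k c =
        mod-trans (mod-reflexive (trans (prefixParikh-+ w (length X) j c)
                                        (cong₂ (λ x y → parikh x c + parikh y c) X-at-0 shifted)))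
                  (mod-+ (period (slice w 0 i) c) (mod-refl {x = prefixParikh w j c}))
        where
        X-at-0 : slice w 0 (length X) ≡ X
        X-at-0 = proj₁ (imageOfPrefix-followed-by-φ^[a] wi≡a n)
        shifted : slice w (length X) j ≡ slice w 0 j
        shifted = slice-prefix w j φ^[a]-twice (ℕ.≤-trans (ℕ.m≤m+n j (length u)) j+|u|≤L)

    Attained : Vector ℤ σ → Set
    Attained v = ∃ λ i → w i ≡ a × prefixParikh w i ≡ᵛ v mod m

    attained-cong : ∀ {u v} → u ≡ᵛ v mod m → Attained u → Attained v
    attained-cong u≡v (i , wi≡a , Pi≡u) = i , wi≡a , λ c → mod-trans (Pi≡u c) (u≡v c)

    attained-zero : Attained (λ _ → + 0)
    attained-zero = 0 , ∷-injectiveˡ (prefix 0) , λ _ → mod-refl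

    attained-+ : ∀ {u v} → Attained u → Attained v → Attained (λ c → u c + v c)
    attained-+ (i , wi≡a , Pi≡u) (j , wj≡a , Pj≡v) =
      let k , a-at-k , Pk≡Pi+Pj = occurrence-translate wi≡a (a ∷ []) (cong (_∷ []) wj≡a)
      in k , ∷-injectiveˡ a-at-k , λ c → mod-trans (Pk≡Pi+Pj c) (mod-+ (Pi≡u c) (Pj≡v c))

    attained-*ℕ : ∀ {v} → Attained v → ∀ k → Attained (λ c → + k * v c)
    attained-*ℕ {v} _  zero    = attained-cong (λ c → mod-reflexive (sym (ℤ.*-zeroˡ (v c)))) attained-zero
    attained-*ℕ {v} av (suc k) =
      attained-cong (λ c → mod-reflexive (sym (suc-* k (v c)))) (attained-+ av (attained-*ℕ av k))
      where
      suc-* : ∀ k x → + suc k * x ≡ x + + k * x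
      suc-* k x = trans (cong (_* x) (ℤ.pos-+ 1 k))
                        (trans (ℤ.*-distribʳ-+ x (+ 1) (+ k)) (cong (_+ + k * x) (ℤ.*-identityˡ x)))

    -- In ℤ/mℤ, negation is multiplication by m - 1.
    attained-neg : ∀ {v} → Attained v → Attained (λ c → - v c)
    attained-neg {v} av =
      attained-cong (λ c → congruent (divides (v c) (pred-m-times (v c)))) (attained-*ℕ av (m ℕ.∸ 1))
      where
      m-1+1≡m : + (m ℕ.∸ 1) + + 1 ≡ + m
      m-1+1≡m = trans (sym (ℤ.pos-+ (m ℕ.∸ 1) 1)) (cong +_ (ℕ.m∸n+n≡m (ℕ.>-nonZero⁻¹ m)))
      pred-m-times : ∀ x → + (m ℕ.∸ 1) * x - - x ≡ x * + m
      pred-m-times x = trans (regroup (+ (m ℕ.∸ 1)) x) (cong (x *_) m-1+1≡m)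
        where
        regroup : ∀ p x → p * x - - x ≡ x * (p + + 1)
        regroup = solve-∀

    attained-* : ∀ z {v} → Attained v → Attained (λ c → z * v c)
    attained-* (+ k)      av = attained-*ℕ av k
    attained-* -[1+ k ] {v} av =
      attained-cong (λ c → mod-reflexive (ℤ.neg-distribˡ-* (+ suc k) (v c))) (attained-neg (attained-*ℕ av (suc k)))

    attained-return : (r : Return w (w 0)) → Attained (returnParikh {w = w} r)
    attained-return (i , j , i<j , wi≡w0 , wj≡w0 , _) =
      attained-cong (λ c → mod-reflexive (difference c))
                    (attained-+ (j , trans wj≡w0 w₀≡a , λ _ → mod-refl)
                                (attained-neg (i , trans wi≡w0 w₀≡a , λ _ → mod-refl)))
      where
      w₀≡a = ∷-injectiveˡ (prefix 0)
      difference : ∀ c → prefixParikh w j c + - prefixParikh w i c ≡ parikh (slice w i (j ℕ.∸ i)) c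
      difference c = begin
        prefixParikh w j c + - prefixParikh w i c
          ≡⟨ cong (λ j′ → prefixParikh w j′ c + - prefixParikh w i c) (ℕ.m+[n∸m]≡n (ℕ.<⇒≤ i<j)) ⟨
        prefixParikh w (i ℕ.+ (j ℕ.∸ i)) c + - prefixParikh w i c
          ≡⟨ cong (_+ - prefixParikh w i c) (prefixParikh-+ w i (j ℕ.∸ i) c) ⟩
        prefixParikh w i c + parikh (slice w i (j ℕ.∸ i)) c + - prefixParikh w i c
          ≡⟨ cancel (prefixParikh w i c) _ ⟩
        parikh (slice w i (j ℕ.∸ i)) c ∎
        where
        cancel : ∀ x y → x + y + - x ≡ y
        cancel = solve-∀

    attained-combo : ∀ rs → Attained (combo {w = w} rs)
    attained-combo []             = attained-zero
    attained-combo ((z , r) ∷ rs) = attained-+ (attained-* z (attained-return r)) (attained-combo rs)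

    welldoc-at : ReturnsGenerate w → ∀ u → IsFactor w u → ∀ (v : Fin σ → ℕ) →
      ∃ λ k → OccursAt w u k × (∀ c → count c (slice w 0 k) ℕ.% m ≡ v c ℕ.% m)
    welldoc-at generate u (j , u-at-j) v =
      let rs , combo≗ = generate (λ c → + v c - prefixParikh w j c)
          i , wi≡a , Pi≡v-Pj = attained-cong (λ c → mod-reflexive (combo≗ c)) (attained-combo rs)
          k , u-at-k , Pk≡Pi+Pj = occurrence-translate wi≡a u u-at-j
      in k , u-at-k , λ c →
           mod⇒%-≡ m _ _ (mod-trans (Pk≡Pi+Pj c)
                           (mod-trans (mod-+ (Pi≡v-Pj c) (mod-refl {x = prefixParikh w j c}))
                                      (mod-reflexive (sub-add (+ v c) (prefixParikh w j c)))))
      where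
      sub-add : ∀ x y → x - y + y ≡ x
      sub-add = solve-∀

returnsGenerate⇒welldoc : ∀ {σ} (φ : Morphism σ) (w : InfWord σ) → Nonerasing φ → GeneratedBy φ w →
  det σ (incMatrix φ) * det σ (incMatrix φ) ≡ + 1 → ReturnsGenerate w → WELLDOC w
returnsGenerate⇒welldoc φ w nonerasing (a , s , φa≡as , s≢[] , prefix) det²≡1 generate m =
  Generated.welldoc-at φ w nonerasing a s φa≡as s≢[] prefix det²≡1 m generate

-- WELLDOC ⇒ returns generate ℤ^σ

module _ {σ} (w : InfWord σ) where

  Combination : Vector ℤ σ → Set
  Combination v = Σ (List (ℤ × Return w (w 0))) λ rs → combo {w = w} rs ≗ v

  combination-cong : ∀ {u v} → u ≗ v → Combination u → Combination v
  combination-cong u≗v (rs , rs≗u) = rs , λ c → trans (rs≗u c) (u≗v c)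

  combination-zero : Combination (λ _ → + 0)
  combination-zero = [] , λ _ → refl

  combo-++ : ∀ (rs ss : List (ℤ × Return w (w 0))) c →
    combo {w = w} (rs ++ ss) c ≡ combo {w = w} rs c + combo {w = w} ss c
  combo-++ []             ss c = sym (ℤ.+-identityˡ (combo {w = w} ss c))
  combo-++ ((z , r) ∷ rs) ss c =
    trans (cong (_+_ (z * returnParikh {w = w} r c)) (combo-++ rs ss c))
          (sym (ℤ.+-assoc (z * returnParikh {w = w} r c) (combo {w = w} rs c) (combo {w = w} ss c)))

  combination-+ : ∀ {u v} → Combination u → Combination v → Combination (λ c → u c + v c)
  combination-+ (rs , rs≗u) (ss , ss≗v) =
    rs ++ ss , λ c → trans (combo-++ rs ss c) (cong₂ _+_ (rs≗u c) (ss≗v c))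

  combination-* : ∀ z {v} → Combination v → Combination (λ c → z * v c)
  combination-* z (rs , rs≗v) = scaled rs , λ c → trans (combo-scaled rs c) (cong (z *_) (rs≗v c))
    where
    scaled : List (ℤ × Return w (w 0)) → List (ℤ × Return w (w 0))
    scaled []             = []
    scaled ((k , r) ∷ rs) = (z * k , r) ∷ scaled rs
    combo-scaled : ∀ rs c → combo {w = w} (scaled rs) c ≡ z * combo {w = w} rs c
    combo-scaled []             c = sym (ℤ.*-zeroʳ z)
    combo-scaled ((k , r) ∷ rs) c = trans (cong (_+_ (z * k * returnParikh {w = w} r c)) (combo-scaled rs c))
                                          (distrib z k (returnParikh {w = w} r c) (combo {w = w} rs c))
      where
      distrib : ∀ z k x y → z * k * x + z * y ≡ z * (k * x + y)
      distrib = solve-∀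

  combination-∑ : ∀ {n} {f : Fin n → Vector ℤ σ} →
    (∀ i → Combination (f i)) → Combination (λ c → ∑[ i < n ] f i c)
  combination-∑ {zero}  _     = combination-zero
  combination-∑ {suc n} comb = combination-+ (comb fzero) (combination-∑ (comb ∘ fsuc))

  combination-∣∣ : ∀ (f : Vector ℤ σ) d → Combination (λ k → f k * d) → Combination (λ k → f k * + ∣ d ∣)
  combination-∣∣ f d comb with ℤ.+∣i∣≡i⊎+∣i∣≡-i d
  ... | inj₁ ∣d∣≡d  = combination-cong (λ k → cong (f k *_) (sym ∣d∣≡d)) comb
  ... | inj₂ ∣d∣≡-d =
    combination-cong (λ k → trans (negate (f k) d) (cong (f k *_) (sym ∣d∣≡-d))) (combination-* (- + 1) comb)
    where
    negate : ∀ x d → - + 1 * (x * d) ≡ x * - d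
    negate = solve-∀

  combination-return : (r : Return w (w 0)) → Combination (returnParikh {w = w} r)
  combination-return r = (+ 1 , r) ∷ [] , λ c → trans (ℤ.+-identityʳ _) (ℤ.*-identityˡ _)

  last-occurrence : ∀ t → ∃ λ j → j ℕ.≤ t × w j ≡ w 0 × (∀ k → j ℕ.< k → k ℕ.≤ t → w k ≢ w 0)
  last-occurrence zero = 0 , ℕ.z≤n , refl , λ k 0<k k≤0 → ⊥-elim (ℕ.<⇒≱ 0<k k≤0)
  last-occurrence (suc t) with w (suc t) ≟ w 0 | last-occurrence t
  ... | yes wt≡w0 | _ = suc t , ℕ.≤-refl , wt≡w0 , λ k t<k k≤t → ⊥-elim (ℕ.<⇒≱ t<k k≤t)
  ... | no  wt≢w0 | j , j≤t , wj≡w0 , gap = j , ℕ.m≤n⇒m≤1+n j≤t , wj≡w0 , gap′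
    where
    gap′ : ∀ k → j ℕ.< k → k ℕ.≤ suc t → w k ≢ w 0
    gap′ k j<k k≤1+t with ℕ.m≤n⇒m<n∨m≡n k≤1+t
    ... | inj₁ k<1+t = gap k j<k (ℕ.≤-pred k<1+t)
    ... | inj₂ refl  = wt≢w0

  prefix-combination : ∀ i → w i ≡ w 0 → Combination (prefixParikh w i)
  prefix-combination = <-rec _ step
    where
    step : ∀ i → (∀ {j} → j ℕ.< i → w j ≡ w 0 → Combination (prefixParikh w j)) →
           w i ≡ w 0 → Combination (prefixParikh w i)
    step zero    _  _      = combination-zero
    step (suc i) ih wi≡w0 with last-occurrence i
    ... | j , j≤i , wj≡w0 , gap =
      combination-cong telescope (combination-+ (ih (ℕ.s≤s j≤i) wj≡w0) (combination-return return))
      where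
      return : Return w (w 0)
      return = j , suc i , ℕ.s≤s j≤i , wj≡w0 , wi≡w0 , λ k j<k k<1+i → gap k j<k (ℕ.≤-pred k<1+i)
      telescope : (λ c → prefixParikh w j c + returnParikh {w = w} return c) ≗ prefixParikh w (suc i)
      telescope c = trans (sym (prefixParikh-+ w j (suc i ℕ.∸ j) c))
                          (cong (λ l → prefixParikh w l c) (ℕ.m+[n∸m]≡n (ℕ.m≤n⇒m≤1+n j≤i)))

  combination-mod : ∀ m → (∀ r → Combination (λ k → δ k r * + m)) →
    ∀ {u v} → u ≡ᵛ v mod m → Combination u → Combination v
  combination-mod m multiples {u} {v} u≡v comb-u =
    combination-cong back (combination-+ comb-u (combination-∑ (λ r → combination-* (- q r) (multiples r))))
    where
    q : Fin σ → ℤ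
    q c = _∣_.quotient (_≡_mod_.divides-difference (u≡v c))
    back : (λ c → u c + ∑[ r < σ ] (- q r * (δ c r * + m))) ≗ v
    back c = begin
      u c + ∑[ r < σ ] (- q r * (δ c r * + m))
        ≡⟨ cong (_+_ (u c)) (∑-pick _ c off-diagonal) ⟩
      u c + - q c * (δ c c * + m)
        ≡⟨ cong (λ e → u c + - q c * (e * + m)) (δ-diag c) ⟩
      u c + - q c * (+ 1 * + m)
        ≡⟨ unit (u c) (q c) (+ m) ⟩
      u c - q c * + m
        ≡⟨ cong (_-_ (u c)) (_∣_.equality (_≡_mod_.divides-difference (u≡v c))) ⟨
      u c - (u c - v c)
        ≡⟨ cancel (u c) (v c) ⟩
      v c ∎
      where
      off-diagonal : ∀ r → r ≢ c → - q r * (δ c r * + m) ≡ + 0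
      off-diagonal r r≢c = trans (cong (λ e → - q r * (e * + m)) (δ-≢ (r≢c ∘ sym))) (vanish (q r) (+ m))
        where
        vanish : ∀ x y → - x * (+ 0 * y) ≡ + 0
        vanish = solve-∀
      unit : ∀ x q y → x + - q * (+ 1 * y) ≡ x - q * y
      unit = solve-∀
      cancel : ∀ x y → x - (x - y) ≡ y
      cancel = solve-∀

occurrence-with-residue : ∀ {σ} (w : InfWord σ) → WELLDOC w → ∀ m .{{_ : NonZero m}} (v : Vector ℤ σ) →
  ∃ λ i → w i ≡ w 0 × prefixParikh w i ≡ᵛ v mod m
occurrence-with-residue w welldoc m v with welldoc m (w 0 ∷ []) (0 , refl) (λ c → v c %ℕ m)
... | i , w0-at-i , residues = i , ∷-injectiveˡ w0-at-i , λ c →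
  %ℕ-≡⇒mod m _ _ (trans (residues c) (m<n⇒m%n≡m (n%ℕd<d (v c) m)))

combination-det-multiples : ∀ {n} (w : InfWord (suc n)) (B : Matrix (suc n)) →
  (∀ k → Combination w (λ c → B c k)) → ∀ r → Combination w (λ k → δ k r * det (suc n) B)
combination-det-multiples w B columns r =
  combination-cong w (λ k → trans (sum-cong-≗ (λ c → ℤ.*-comm (cofactor B r c) (B k c))) (cofactor-expansion B k r))
                     (combination-∑ w (λ c → combination-* w (cofactor B r c) (columns c)))

welldoc⇒returnsGenerate : ∀ {σ} (w : InfWord σ) → WELLDOC w → ReturnsGenerate w
welldoc⇒returnsGenerate {zero}  w _ with w 0
... | ()
welldoc⇒returnsGenerate {suc n} w welldoc v =
  let p , wp≡w0 , Pp≡v = occurrence-with-residue w welldoc ∣ D ∣ v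
  in combination-mod w ∣ D ∣ ∣D∣-multiples Pp≡v (prefix-combination w p wp≡w0)
  where
  unit-residue : ∀ k → ∃ λ i → w i ≡ w 0 × prefixParikh w i ≡ᵛ (λ c → δ c k) mod 2
  unit-residue k = occurrence-with-residue w welldoc 2 (λ c → δ c k)
  B : Matrix (suc n)
  B c k = prefixParikh w (proj₁ (unit-residue k)) c
  columns : ∀ k → Combination w (λ c → B c k)
  columns k = prefix-combination w _ (proj₁ (proj₂ (unit-residue k)))
  D = det (suc n) B
  D≢0 : D ≢ + 0
  D≢0 = odd⇒≢0 (mod-trans (det-cong-mod (suc n) (λ c k → proj₂ (proj₂ (unit-residue k)) c))
                          (mod-reflexive (det-δ (suc n))))
  ∣D∣-multiples : ∀ r → Combination w (λ k → δ k r * + ∣ D ∣)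
  ∣D∣-multiples r = combination-∣∣ w (λ k → δ k r) D (combination-det-multiples w B columns r)
  instance
    ∣D∣≢0 : NonZero ∣ D ∣
    ∣D∣≢0 = ℕ.≢-nonZero (D≢0 ∘ ℤ.∣i∣≡0⇒i≡0)

theorem3 : (σ : ℕ) (φ : Morphism σ) (w : InfWord σ) →
    Nonerasing φ → GeneratedBy φ w → Recurrent w →
    (det σ (incMatrix φ) ≡ + 1 ⊎ det σ (incMatrix φ) ≡ - (+ 1)) →
    (WELLDOC w ⇔ ReturnsGenerate w)
theorem3 σ φ w nonerasing generated _ unimodular =
  mk⇔ (welldoc⇒returnsGenerate w) (returnsGenerate⇒welldoc φ w nonerasing generated (square-unit unimodular))
  where
  square-unit : ∀ {d} → d ≡ + 1 ⊎ d ≡ - (+ 1) → d * d ≡ + 1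
  square-unit (inj₁ refl) = refl
  square-unit (inj₂ refl) = refl
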